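{- Let $N$ be a finite set with $|N|\ge2$. The cones $B(N)$ and $E(N)$ are closed under reflection: if $m\in B(N)$ then $m^*\in B(N)$, and if $m\in E(N)$ then $m^*\in E(N)$, where $m^*(T):=m(N\setminus T)$ for $T\subseteq N$.
   Context: For $m:\mathcal{P}(N)\to\mathbb{R}$ let $\tilde m(S)=m(S)-m(\emptyset)$ (a game, i.e. $\tilde m(\emptyset)=0$). The core of a game $g$ is $C(g)=\{x\in\mathbb{R}^N:\sum_{i\in N}x_i=g(N),\ \sum_{i\in S}x_i\ge g(S)\ \forall S\subseteq N\}$. $B(N)=\{m:C(\tilde m)\ne\emptyset\}$; $E(N)=\{m: \text{for every } S\subseteq N \text{ there is } x\in C(\tilde m) \text{ with } \sum_{i\in S}x_i=\tilde m(S)\}$. -}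

module Defs where

open import Level using (Level; _⊔_) renaming (suc to lsuc)
open import Data.Nat using (ℕ; zero; suc)
open import Data.Fin using (Fin) renaming (zero to fzero; suc to fsuc)
open import Data.Fin.Subset using (Subset; ⊥; ⊤; ∁)
open import Data.Bool using (true; false)
open import Data.Vec using (_∷_; [])
open import Data.Product using (∃; _×_)
open import Relation.Nullary using (¬_)
open import Relation.Binary using (Rel; IsTotalOrder)
open import Algebra.Bundles using (CommutativeRing)

record OrderedField c ℓ₁ ℓ₂ : Set (lsuc (c ⊔ ℓ₁ ⊔ ℓ₂)) where
  field
    commutativeRing : CommutativeRing c ℓ₁
  open CommutativeRing commutativeRing public
  field
    _≤_          : Rel Carrier ℓ₂
    isTotalOrder : IsTotalOrder _≈_ _≤_
    +-mono-≤     : ∀ {x y} z → x ≤ y → (x + z) ≤ (y + z)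
    *-nonneg     : ∀ {x y} → 0# ≤ x → 0# ≤ y → 0# ≤ (x * y)
    0≉1          : ¬ (0# ≈ 1#)
    inverse      : ∀ x → ¬ (x ≈ 0#) → ∃ λ y → (x * y) ≈ 1#

module Games {c ℓ₁ ℓ₂} (F : OrderedField c ℓ₁ ℓ₂) where
  open OrderedField F

  sumOver : ∀ {n} → (Fin n → Carrier) → Subset n → Carrier
  sumOver {zero}  x []            = 0#
  sumOver {suc n} x (true  ∷ S)   = x fzero + sumOver (λ i → x (fsuc i)) S
  sumOver {suc n} x (false ∷ S)   = sumOver (λ i → x (fsuc i)) S

  normalize : ∀ {n} → (Subset n → Carrier) → Subset n → Carrier
  normalize m S = m S - m ⊥

  InCore : ∀ {n} → (Subset n → Carrier) → (Fin n → Carrier) → Set (ℓ₁ ⊔ ℓ₂)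
  InCore g x = (sumOver x ⊤ ≈ g ⊤) × (∀ S → g S ≤ sumOver x S)

  B : ∀ n → (Subset n → Carrier) → Set (c ⊔ ℓ₁ ⊔ ℓ₂)
  B n m = ∃ λ (x : Fin n → Carrier) → InCore (normalize m) x

  E : ∀ n → (Subset n → Carrier) → Set (c ⊔ ℓ₁ ⊔ ℓ₂)
  E n m = ∀ (S : Subset n) → ∃ λ (x : Fin n → Carrier) →
            InCore (normalize m) x × (sumOver x S ≈ normalize m S)

  reflect : ∀ {n} → (Subset n → Carrier) → Subset n → Carrier
  reflect m T = m (∁ T)

-- If x lies in the core of m̃ then -x lies in the core of m̃*: the complement
-- identity -x(S) = x(N ∖ S) - x(N) and m̃*(S) = m̃(N ∖ S) - m̃(N) turn the core
-- inequality of m̃ at N ∖ S into that of m̃* at S, and tightness at N ∖ S into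
-- tightness at S. Efficiency is tightness at N, which is tightness at ∅ for m̃.
module Submission where

open import Defs
open import Data.Nat using (ℕ; _≤_; zero; suc)
open import Data.Fin using (Fin)
open import Data.Fin.Subset using (Subset; ⊥; ⊤; ∁)
open import Data.Bool using (true; false)
open import Data.Vec using (_∷_; [])
open import Data.Product using (_×_; _,_; proj₁; proj₂)
open import Function using (_∘_)
open import Relation.Binary.PropositionalEquality as ≡ using (_≡_; cong)
open import Relation.Binary.Structures using (IsTotalOrder)
import Relation.Binary.Reasoning.Setoid as SetoidReasoning
import Algebra.Properties.AbelianGroup as AbelianGroupProperties
import Algebra.Properties.CommutativeSemigroup as CommutativeSemigroupProperties

∁⊥≡⊤ : ∀ n → ∁ {n} ⊥ ≡ ⊤
∁⊥≡⊤ zero    = ≡.refl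
∁⊥≡⊤ (suc n) = cong (true ∷_) (∁⊥≡⊤ n)

∁⊤≡⊥ : ∀ n → ∁ {n} ⊤ ≡ ⊥
∁⊤≡⊥ zero    = ≡.refl
∁⊤≡⊥ (suc n) = cong (false ∷_) (∁⊤≡⊥ n)

module Reflection {c ℓ₁ ℓ₂} (F : OrderedField c ℓ₁ ℓ₂) where
  open OrderedField F renaming (_≤_ to _≤ᶠ_)
  open Games F
  open AbelianGroupProperties +-abelianGroup using (ε⁻¹≈ε; ⁻¹-∙-comm; ⁻¹-anti-homo‿-)
  open CommutativeSemigroupProperties +-commutativeSemigroup using (x∙yz≈y∙xz)
  open IsTotalOrder isTotalOrder using (≲-respˡ-≈; ≲-respʳ-≈)
  open SetoidReasoning setoid

  x+y≈z⇒-x≈y-z : ∀ {x y z} → x + y ≈ z → - x ≈ y - z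
  x+y≈z⇒-x≈y-z {x} {y} {z} x+y≈z = begin
    - x              ≈⟨ +-identityʳ (- x) ⟨
    - x + 0#         ≈⟨ +-cong refl (-‿inverseʳ y) ⟨
    - x + (y - y)    ≈⟨ x∙yz≈y∙xz (- x) y (- y) ⟩
    y + (- x - y)    ≈⟨ +-cong refl (⁻¹-∙-comm x y) ⟩
    y - (x + y)      ≈⟨ +-cong refl (-‿cong x+y≈z) ⟩
    y - z            ∎

  [x-z]-[y-z]≈x-y : ∀ x y z → (x - z) - (y - z) ≈ x - y
  [x-z]-[y-z]≈x-y x y z = begin
    (x - z) - (y - z)    ≈⟨ +-cong refl (⁻¹-anti-homo‿- y z) ⟩
    (x - z) + (z - y)    ≈⟨ +-assoc x (- z) (z - y) ⟩
    x + (- z + (z - y))  ≈⟨ +-cong refl (+-assoc (- z) z (- y)) ⟨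
    x + ((- z + z) - y)  ≈⟨ +-cong refl (+-cong (-‿inverseˡ z) refl) ⟩
    x + (0# - y)         ≈⟨ +-cong refl (+-identityˡ (- y)) ⟩
    x - y                ∎

  sumOver-⊥ : ∀ {n} (x : Fin n → Carrier) → sumOver x ⊥ ≈ 0#
  sumOver-⊥ {zero}  x = refl
  sumOver-⊥ {suc n} x = sumOver-⊥ {n} _

  sumOver-neg : ∀ {n} (x : Fin n → Carrier) S → sumOver (-_ ∘ x) S ≈ - sumOver x S
  sumOver-neg {zero}  x []          = sym ε⁻¹≈ε
  sumOver-neg {suc n} x (true ∷ S)  = trans (+-cong refl (sumOver-neg _ S)) (⁻¹-∙-comm _ _)
  sumOver-neg {suc n} x (false ∷ S) = sumOver-neg _ S

  sumOver-∁ : ∀ {n} (x : Fin n → Carrier) S → sumOver x S + sumOver x (∁ S) ≈ sumOver x ⊤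
  sumOver-∁ {zero}  x []          = +-identityˡ 0#
  sumOver-∁ {suc n} x (true ∷ S)  = trans (+-assoc _ _ _) (+-cong refl (sumOver-∁ _ S))
  sumOver-∁ {suc n} x (false ∷ S) = trans (x∙yz≈y∙xz _ _ _) (+-cong refl (sumOver-∁ _ S))

  sumOver-neg-∁ : ∀ {n} (x : Fin n → Carrier) S →
                  sumOver (-_ ∘ x) S ≈ sumOver x (∁ S) - sumOver x ⊤
  sumOver-neg-∁ x S = trans (sumOver-neg x S) (x+y≈z⇒-x≈y-z (sumOver-∁ x S))

  normalize-⊥ : ∀ {n} (m : Subset n → Carrier) → normalize m ⊥ ≈ 0#
  normalize-⊥ m = -‿inverseʳ (m ⊥)

  normalize-reflect : ∀ {n} (m : Subset n → Carrier) S →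
                      normalize (reflect m) S ≈ normalize m (∁ S) - normalize m ⊤
  normalize-reflect {n} m S = begin
    m (∁ S) - m (∁ ⊥)                  ≈⟨ +-cong refl (-‿cong (reflexive (cong m (∁⊥≡⊤ n)))) ⟩
    m (∁ S) - m ⊤                      ≈⟨ [x-z]-[y-z]≈x-y (m (∁ S)) (m ⊤) (m ⊥) ⟨
    (m (∁ S) - m ⊥) - (m ⊤ - m ⊥)      ∎

  module _ {n} {m : Subset n → Carrier} {x : Fin n → Carrier}
           (x∈C : InCore (normalize m) x) where

    sumOver-neg-∁-core : ∀ S → sumOver (-_ ∘ x) S ≈ sumOver x (∁ S) - normalize m ⊤
    sumOver-neg-∁-core S = trans (sumOver-neg-∁ x S) (+-cong refl (-‿cong (proj₁ x∈C)))

    neg-tight-reflect : ∀ S → sumOver x (∁ S) ≈ normalize m (∁ S) →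
                        sumOver (-_ ∘ x) S ≈ normalize (reflect m) S
    neg-tight-reflect S tight = begin
      sumOver (-_ ∘ x) S                   ≈⟨ sumOver-neg-∁-core S ⟩
      sumOver x (∁ S) - normalize m ⊤      ≈⟨ +-cong tight refl ⟩
      normalize m (∁ S) - normalize m ⊤    ≈⟨ normalize-reflect m S ⟨
      normalize (reflect m) S              ∎

    tight-∁⊤ : sumOver x (∁ ⊤) ≈ normalize m (∁ ⊤)
    tight-∁⊤ = begin
      sumOver x (∁ ⊤)      ≡⟨ cong (sumOver x) (∁⊤≡⊥ n) ⟩
      sumOver x ⊥          ≈⟨ sumOver-⊥ x ⟩
      0#                   ≈⟨ normalize-⊥ m ⟨
      normalize m ⊥        ≡⟨ cong (normalize m) (∁⊤≡⊥ n) ⟨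
      normalize m (∁ ⊤)    ∎

    neg-inCore-reflect : InCore (normalize (reflect m)) (-_ ∘ x)
    neg-inCore-reflect = neg-tight-reflect ⊤ tight-∁⊤ , stable
      where
      stable : ∀ S → normalize (reflect m) S ≤ᶠ sumOver (-_ ∘ x) S
      stable S = ≲-respʳ-≈ (sym (sumOver-neg-∁-core S))
                   (≲-respˡ-≈ (sym (normalize-reflect m S))
                     (+-mono-≤ (- normalize m ⊤) (proj₂ x∈C (∁ S))))

  B-reflect : ∀ n (m : Subset n → Carrier) → B n m → B n (reflect m)
  B-reflect n m (x , x∈C) = -_ ∘ x , neg-inCore-reflect x∈C

  E-reflect : ∀ n (m : Subset n → Carrier) → E n m → E n (reflect m)
  E-reflect n m exact S =
    let x , x∈C , tight = exact (∁ S)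
    in -_ ∘ x , neg-inCore-reflect x∈C , neg-tight-reflect x∈C S tight

lemma5 : ∀ {c ℓ₁ ℓ₂} (F : OrderedField c ℓ₁ ℓ₂) (n : ℕ) → 2 ≤ n →
           (∀ (m : Subset n → OrderedField.Carrier F) → Games.B F n m → Games.B F n (Games.reflect F m))
         × (∀ (m : Subset n → OrderedField.Carrier F) → Games.E F n m → Games.E F n (Games.reflect F m))
lemma5 F n _ = Reflection.B-reflect F n , Reflection.E-reflect F n
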